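{- For each orbit $\mathcal{O}$ of $\mathrm{Pro}$ on $\mathrm{Inc}^q(P)$, there exists an orbit $\mathcal{O}'$ such that for all $f \in \mathcal{O}$, $\textnormal{swap}(f) \in \mathcal{O}'$.
   Context: $P$ is a finite self-dual poset with fixed order-reversing involution $\kappa$. $\mathrm{Inc}^q(P)$ is the set of increasing labelings $f:P\to[q]$ ($f(x)<f(y)$ whenever $x<y$). Promotion $\mathrm{Pro}$: replace labels $1$ by empty boxes; for $i=2,\dots,q$ slide boxes upward (a box at $x$ becomes $i$ if some $y\gtrdot x$ is labeled $i$, and that element becomes a box); replace boxes by $q+1$ and subtract $1$ from all labels. $\mathrm{swap}(f)(x)=q+1-f(\kappa(x))$. -}

module Defs where

open import Data.Nat using (ℕ; zero; suc; _≤_; _<_; _∸_; _≡ᵇ_)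
open import Data.Fin using (Fin)
open import Data.Bool using (Bool; true; false; _∧_; not; if_then_else_)
open import Data.List using (allFin)
open import Data.Bool.ListAction using (any)
open import Data.Maybe using (Maybe; just; nothing)
open import Data.Product using (_×_)
open import Relation.Binary using (Rel; Decidable)
open import Relation.Nullary using (¬_)
open import Relation.Nullary.Decidable using (⌊_⌋)
open import Relation.Binary.PropositionalEquality using (_≡_)

record FinPoset : Set₁ where
  field
    n       : ℕ
    _≺_     : Rel (Fin n) _
    ≺-dec   : Decidable _≺_
    ≺-irrefl : ∀ x → ¬ (x ≺ x)
    ≺-trans : ∀ {x y z} → x ≺ y → y ≺ z → x ≺ z

module _ (P : FinPoset) where
  open FinPoset P

  lt : Fin n → Fin n → Bool
  lt x y = ⌊ ≺-dec x y ⌋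

  covers : Fin n → Fin n → Bool
  covers x y = lt x y ∧ not (any (λ z → lt x z ∧ lt z y) (allFin n))

  record IsSelfDual (κ : Fin n → Fin n) : Set where
    field
      involutive     : ∀ x → κ (κ x) ≡ x
      order-reversing : ∀ x y → x ≺ y → κ y ≺ κ x

  Inc : ℕ → (Fin n → ℕ) → Set
  Inc q f = (∀ x → (1 ≤ f x) × (f x ≤ q)) × (∀ x y → x ≺ y → f x < f y)

  -- Partial labelings: nothing = empty box.
  isLabel : ℕ → Maybe ℕ → Bool
  isLabel i (just k) = i ≡ᵇ k
  isLabel i nothing  = false

  isBox : Maybe ℕ → Bool
  isBox nothing  = true
  isBox (just _) = false

  slideStep : ℕ → (Fin n → Maybe ℕ) → (Fin n → Maybe ℕ)
  slideStep i g x =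
    if isBox (g x) ∧ any (λ y → covers x y ∧ isLabel i (g y)) (allFin n)
    then just i
    else (if isLabel i (g x) ∧ any (λ z → covers z x ∧ isBox (g z)) (allFin n)
          then nothing
          else g x)

  slides : ℕ → (Fin n → Maybe ℕ) → (Fin n → Maybe ℕ)
  slides zero          g = g
  slides (suc zero)    g = g
  slides (suc (suc k)) g = slideStep (suc (suc k)) (slides (suc k) g)

  Pro : ℕ → (Fin n → ℕ) → (Fin n → ℕ)
  Pro q f x with slides q start x
    where
    start : Fin n → Maybe ℕ
    start y = if f y ≡ᵇ 1 then nothing else just (f y)
  ... | nothing = q            -- box ↦ q+1, then subtract 1
  ... | just k  = k ∸ 1

  swap : ℕ → (Fin n → Fin n) → (Fin n → ℕ) → (Fin n → ℕ)
  swap q κ f x = suc q ∸ f (κ x)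

iterate : {A : Set} → (A → A) → ℕ → A → A
iterate h zero    a = a
iterate h (suc k) a = h (iterate h k a)

{-# OPTIONS --safe #-}
module Submission where

-- Promotion on Inc^q(P) is the composite τ_{q-1} ∘ ⋯ ∘ τ₁ of the toggles τᵢ,
-- which exchange the labels i and i+1 wherever the labeling stays increasing:
-- after the slides 2, …, k the partially slid labeling, suitably read, is
-- τ_{k-1} ∘ ⋯ ∘ τ₁ f.  Each τᵢ is an involution and swap conjugates τᵢ to
-- τ_{q-i}, so swap ∘ Pro ∘ swap = τ₁ ∘ ⋯ ∘ τ_{q-1} = Pro⁻¹.  In particular Pro
-- is injective on the finite set Inc^q(P), every orbit is periodic, and
-- swap (Pro^k f) = Pro^{-k} (swap f) lies in the orbit of swap f.

open import Defs
open import Data.Bool using (Bool; true; false; T; _∧_; if_then_else_)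
open import Data.Bool.ListAction using (any; or)
open import Data.Bool.Properties using (if-float; T-∧; T-≡; T-not-≡)
open import Data.Fin using (Fin; toℕ; fromℕ<; funToFin; finToFun)
open import Data.Fin.Properties using (toℕ-fromℕ<; finToFun-funToFin; pigeonhole)
open import Data.List using (List; []; _∷_; _∷ʳ_; [_]; allFin; foldr; map; reverse; applyDownFrom; applyUpTo)
open import Data.List.Membership.Propositional using (lose)
open import Data.List.Membership.Propositional.Properties using (∈-allFin)
open import Data.List.Properties
  using (map-cong; foldr-++; unfold-reverse; reverse-involutive; applyUpTo-∷ʳ; applyDownFrom-∷ʳ; map-applyDownFrom)
open import Data.List.Relation.Unary.All using (All; []; _∷_)
open import Data.List.Relation.Unary.All.Properties using (applyDownFrom⁺₁)
open import Data.List.Relation.Unary.Any using (satisfied)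
open import Data.List.Relation.Unary.Any.Properties using (any⁺; any⁻)
open import Data.Maybe using (Maybe; just; nothing)
open import Data.Nat
  using (ℕ; zero; suc; _+_; _*_; _^_; _∸_; _≤_; _<_; _≰_; _⊓_; _⊔_; _≡ᵇ_; s≤s; z≤n)
open import Data.Nat.Properties
open import Data.Product using (Σ; ∃; ∃₂; _×_; _,_; proj₁; proj₂)
open import Function.Base using (_∘_; _$_)
open import Function.Bundles using (Equivalence; _⇔_; mk⇔)
open import Relation.Binary.Definitions using (tri<; tri≈; tri>)
open import Relation.Binary.PropositionalEquality
  using (_≡_; _≢_; _≗_; refl; sym; trans; cong; cong₂; subst; subst₂; ≢-sym; module ≡-Reasoning)
open import Relation.Nullary using (¬_; yes; no; contradiction)
open import Relation.Nullary.Decidable using (toWitness; fromWitness; T?)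

if-T : ∀ {A : Set} {b} {x y : A} → T b → (if b then x else y) ≡ x
if-T {b = true} _ = refl

if-¬T : ∀ {A : Set} {b} {x y : A} → ¬ T b → (if b then x else y) ≡ y
if-¬T {b = true}  ¬b = contradiction _ ¬b
if-¬T {b = false} _  = refl

if-elim : ∀ {A : Set} (C : A → Set) b {x y} → C x → C y → C (if b then x else y)
if-elim C true  cx _  = cx
if-elim C false _  cy = cy

¬T⇒≡false : ∀ {b} → ¬ T b → b ≡ false
¬T⇒≡false {false} _  = refl
¬T⇒≡false {true}  ¬t = contradiction _ ¬t

T-injective : ∀ {a b} → T a ⇔ T b → a ≡ b
T-injective {false} {false} _   = refl
T-injective {false} {true}  a⇔b = contradiction (Equivalence.from a⇔b _) λ ()
T-injective {true}  {false} a⇔b = contradiction (Equivalence.to a⇔b _) λ ()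
T-injective {true}  {true}  _   = refl

≡ᵇ-refl : ∀ n → (n ≡ᵇ n) ≡ true
≡ᵇ-refl n = Equivalence.to T-≡ (≡⇒≡ᵇ n n refl)

≢⇒≡ᵇ-false : ∀ {m n} → m ≢ n → (m ≡ᵇ n) ≡ false
≢⇒≡ᵇ-false {m} {n} m≢n = ¬T⇒≡false (m≢n ∘ ≡ᵇ⇒≡ m n)

m≤n⇒m∸1<n : ∀ {m n} → 1 ≤ n → m ≤ n → m ∸ 1 < n
m≤n⇒m∸1<n {zero}  1≤n _   = 1≤n
m≤n⇒m∸1<n {suc m} _   m<n = m<n

iterate-+ : ∀ {A : Set} (h : A → A) m n a → iterate h (m + n) a ≡ iterate h m (iterate h n a)
iterate-+ h zero    n a = refl
iterate-+ h (suc m) n a = cong h (iterate-+ h m n a)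

iterate-suc : ∀ {A : Set} (h : A → A) k a → iterate h (suc k) a ≡ iterate h k (h a)
iterate-suc h zero    a = refl
iterate-suc h (suc k) a = cong h (iterate-suc h k a)

reverse-applyDownFrom : ∀ {A : Set} (f : ℕ → A) n → reverse (applyDownFrom f n) ≡ applyUpTo f n
reverse-applyDownFrom f zero    = refl
reverse-applyDownFrom f (suc n) = begin
  reverse (f n ∷ applyDownFrom f n)   ≡⟨ unfold-reverse (f n) (applyDownFrom f n) ⟩
  reverse (applyDownFrom f n) ∷ʳ f n  ≡⟨ cong (_∷ʳ f n) (reverse-applyDownFrom f n) ⟩
  applyUpTo f n ∷ʳ f n                ≡⟨ applyUpTo-∷ʳ f n ⟩
  applyUpTo f (suc n)                 ∎
  where open ≡-Reasoning

applyDownFrom-∸ : ∀ n → applyDownFrom (n ∸_) n ≡ applyUpTo suc n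
applyDownFrom-∸ zero    = refl
applyDownFrom-∸ (suc n) = begin
  applyDownFrom (suc n ∸_) (suc n)  ≡⟨ applyDownFrom-∷ʳ (suc n ∸_) n ⟨
  applyDownFrom (n ∸_) n ∷ʳ suc n   ≡⟨ cong (_∷ʳ suc n) (applyDownFrom-∸ n) ⟩
  applyUpTo suc n ∷ʳ suc n          ≡⟨ applyUpTo-∷ʳ suc n ⟩
  applyUpTo suc (suc n)             ∎
  where open ≡-Reasoning

encode : ∀ {n q} (g : Fin n → ℕ) → (∀ x → g x ≤ q) → Fin (suc q ^ n)
encode g g≤q = funToFin (λ x → fromℕ< (s≤s (g≤q x)))

encode-injective : ∀ {n q} {g h : Fin n → ℕ} g≤q h≤q →
                   encode {q = q} g g≤q ≡ encode h h≤q → g ≗ h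
encode-injective {g = g} {h} g≤q h≤q eq x = begin
  g x                                 ≡⟨ toℕ-fromℕ< _ ⟨
  toℕ (fromℕ< (s≤s (g≤q x)))          ≡⟨ cong toℕ (finToFun-funToFin _ x) ⟨
  toℕ (finToFun (encode g g≤q) x)     ≡⟨ cong (λ c → toℕ (finToFun c x)) eq ⟩
  toℕ (finToFun (encode h h≤q) x)     ≡⟨ cong toℕ (finToFun-funToFin _ x) ⟩
  toℕ (fromℕ< (s≤s (h≤q x)))          ≡⟨ toℕ-fromℕ< _ ⟩
  h x                                 ∎
  where open ≡-Reasoning

-- Toggles

data Position (i v : ℕ) : Set where
  below  : v < i → Position i v
  at     : v ≡ i → Position i v
  at-suc : v ≡ suc i → Position i v
  above  : suc i < v → Position i v

position : ∀ i v → Position i v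
position i v with <-cmp v i
... | tri< v<i _ _ = below v<i
... | tri≈ _ v≡i _ = at v≡i
... | tri> _ _ i<v with v ≟ suc i
...   | yes v≡1+i = at-suc v≡1+i
...   | no  v≢1+i = above (≤∧≢⇒< i<v (≢-sym v≢1+i))

opaque
  toggle : ℕ → ℕ → Bool → Bool → ℕ
  toggle i v blockedUp blockedDown =
    if v ≡ᵇ i then (if blockedUp then i else suc i)
    else if v ≡ᵇ suc i then (if blockedDown then suc i else i)
    else v

opaque
  unfolding toggle

  toggle-below : ∀ {i v u d} → v < i → toggle i v u d ≡ v
  toggle-below v<i
    rewrite ≢⇒≡ᵇ-false (<⇒≢ v<i) | ≢⇒≡ᵇ-false (<⇒≢ (m<n⇒m<1+n v<i)) = refl

  toggle-above : ∀ {i v u d} → suc i < v → toggle i v u d ≡ v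
  toggle-above {i} i+1<v
    rewrite ≢⇒≡ᵇ-false (>⇒≢ (<-trans (n<1+n i) i+1<v)) | ≢⇒≡ᵇ-false (>⇒≢ i+1<v) = refl

  toggle-at : ∀ {i u d} → toggle i i u d ≡ (if u then i else suc i)
  toggle-at {i} rewrite ≡ᵇ-refl i = refl

  toggle-at-suc : ∀ {i u d} → toggle i (suc i) u d ≡ (if d then suc i else i)
  toggle-at-suc {i} rewrite ≢⇒≡ᵇ-false (1+n≢n {i}) | ≡ᵇ-refl i = refl

module _ {i : ℕ} {u d : Bool} where

  toggle-at-blocked : ∀ {v} → v ≡ i → T u → toggle i v u d ≡ i
  toggle-at-blocked refl t = trans toggle-at (if-T t)

  toggle-at-free : ∀ {v} → v ≡ i → ¬ T u → toggle i v u d ≡ suc i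
  toggle-at-free refl ¬t = trans toggle-at (if-¬T ¬t)

  toggle-at-suc-blocked : ∀ {v} → v ≡ suc i → T d → toggle i v u d ≡ suc i
  toggle-at-suc-blocked refl t = trans toggle-at-suc (if-T t)

  toggle-at-suc-free : ∀ {v} → v ≡ suc i → ¬ T d → toggle i v u d ≡ i
  toggle-at-suc-free refl ¬t = trans toggle-at-suc (if-¬T ¬t)

  private
    unmoved : ∀ {v t} → t ≡ v → v ⊓ i ≤ t × t ≤ v ⊔ suc i
    unmoved {v} refl = m⊓n≤m v i , m≤m⊔n v (suc i)

    between : ∀ {v t} → i ≤ t × t ≤ suc i → v ⊓ i ≤ t × t ≤ v ⊔ suc i
    between {v} (i≤t , t≤i+1) = ≤-trans (m⊓n≤n v i) i≤t , ≤-trans t≤i+1 (m≤n⊔m v (suc i))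

  toggle-bounds : ∀ v → v ⊓ i ≤ toggle i v u d × toggle i v u d ≤ v ⊔ suc i
  toggle-bounds v with position i v
  ... | below v<i   = unmoved (toggle-below v<i)
  ... | above i+1<v = unmoved (toggle-above i+1<v)
  ... | at refl     rewrite toggle-at {i} {u} {d} =
    between (if-elim (λ t → i ≤ t × t ≤ suc i) u (≤-refl , n≤1+n i) (n≤1+n i , ≤-refl))
  ... | at-suc refl rewrite toggle-at-suc {i} {u} {d} =
    between (if-elim (λ t → i ≤ t × t ≤ suc i) d (n≤1+n i , ≤-refl) (≤-refl , n≤1+n i))

toggle-reflect : ∀ {q i w} u d → i ≤ q → w ≤ suc q →
                 suc q ∸ toggle i w u d ≡ toggle (q ∸ i) (suc q ∸ w) d u
toggle-reflect {q} {i} {w} u d i≤q w≤q+1 with position i w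
... | below w<i = begin
  suc q ∸ toggle i w u d              ≡⟨ cong (suc q ∸_) (toggle-below w<i) ⟩
  suc q ∸ w                           ≡⟨ toggle-above q∸i+1<q+1∸w ⟨
  toggle (q ∸ i) (suc q ∸ w) d u      ∎
  where
  open ≡-Reasoning
  q∸i+1<q+1∸w : suc (q ∸ i) < suc q ∸ w
  q∸i+1<q+1∸w = subst (_< suc q ∸ w) (+-∸-assoc 1 i≤q) (∸-monoʳ-< w<i (m≤n⇒m≤1+n i≤q))
... | above i+1<w = begin
  suc q ∸ toggle i w u d              ≡⟨ cong (suc q ∸_) (toggle-above i+1<w) ⟩
  suc q ∸ w                           ≡⟨ toggle-below (∸-monoʳ-< i+1<w w≤q+1) ⟨
  toggle (q ∸ i) (suc q ∸ w) d u      ∎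
  where open ≡-Reasoning
... | at refl = begin
  suc q ∸ toggle i i u d              ≡⟨ cong (suc q ∸_) toggle-at ⟩
  suc q ∸ (if u then i else suc i)    ≡⟨ if-float (suc q ∸_) u ⟩
  (if u then suc q ∸ i else q ∸ i)    ≡⟨ cong (if u then_else q ∸ i) q+1∸i ⟩
  (if u then suc (q ∸ i) else q ∸ i)  ≡⟨ toggle-at-suc ⟨
  toggle (q ∸ i) (suc (q ∸ i)) d u    ≡⟨ cong (λ v → toggle (q ∸ i) v d u) q+1∸i ⟨
  toggle (q ∸ i) (suc q ∸ i) d u      ∎
  where
  open ≡-Reasoning
  q+1∸i = +-∸-assoc 1 i≤q
... | at-suc refl = begin
  suc q ∸ toggle i (suc i) u d        ≡⟨ cong (suc q ∸_) toggle-at-suc ⟩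
  suc q ∸ (if d then suc i else i)    ≡⟨ if-float (suc q ∸_) d ⟩
  (if d then q ∸ i else suc q ∸ i)    ≡⟨ cong (if d then q ∸ i else_) (+-∸-assoc 1 i≤q) ⟩
  (if d then q ∸ i else suc (q ∸ i))  ≡⟨ toggle-at ⟨
  toggle (q ∸ i) (q ∸ i) d u          ∎
  where open ≡-Reasoning

-- Reads the state after the slides 2, …, k as a labeling: the box stands for
-- k and the labels up to k, which have already slid, are lowered by one.
flatten : ℕ → Maybe ℕ → ℕ
flatten k nothing  = k
flatten k (just j) with j ≤? k
... | yes _ = j ∸ 1
... | no  _ = j

flatten-≤ : ∀ {k j} → j ≤ k → flatten k (just j) ≡ j ∸ 1
flatten-≤ {k} {j} j≤k with j ≤? k
... | yes _   = refl
... | no  j≰k = contradiction j≤k j≰k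

flatten-> : ∀ {k j} → k < j → flatten k (just j) ≡ j
flatten-> {k} {j} k<j with j ≤? k
... | yes j≤k = contradiction j≤k (<⇒≱ k<j)
... | no  _   = refl

flatten-≡suc : ∀ {k} v → flatten k v ≡ suc k → v ≡ just (suc k)
flatten-≡suc {k} nothing  k≡k+1 = contradiction k≡k+1 (≢-sym 1+n≢n)
flatten-≡suc {k} (just j) eq with j ≤? k
... | yes j≤k = contradiction (≤-trans (m∸n≤m j 1) j≤k) (subst (_≰ k) (sym eq) 1+n≰n)
... | no  _   = cong just eq

flatten-≡ : ∀ {k} v → 1 ≤ k → flatten k v ≡ k → v ≡ nothing
flatten-≡ nothing _ _ = refl
flatten-≡ {k} (just j) 1≤k eq with j ≤? k
... | yes j≤k = contradiction eq (<⇒≢ (m≤n⇒m∸1<n 1≤k j≤k))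
... | no  j≰k = contradiction (≤-reflexive eq) j≰k

module Labelings (P : FinPoset) where
  open FinPoset P

  Labeling : Set
  Labeling = Fin n → ℕ

  Increasing : Labeling → Set
  Increasing f = ∀ x y → x ≺ y → f x < f y

  Increasing-resp : ∀ {f g} → f ≗ g → Increasing f → Increasing g
  Increasing-resp f≗g f↑ x y x≺y = subst₂ _<_ (f≗g x) (f≗g y) (f↑ x y x≺y)

  Inc-≤suc : ∀ {q f} → Inc P q f → ∀ x → f x ≤ suc q
  Inc-≤suc (f-bounds , _) x = m≤n⇒m≤1+n (proj₂ (f-bounds x))

  Inc-resp : ∀ {q f g} → f ≗ g → Inc P q f → Inc P q g
  Inc-resp f≗g (f-bounds , f↑) =
    (λ x → subst (λ v → 1 ≤ v × v ≤ _) (f≗g x) (f-bounds x)) , Increasing-resp f≗g f↑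

  some : (Fin n → Bool) → Bool
  some p = any p (allFin n)

  some⁺ : ∀ {p} x → T (p x) → T (some p)
  some⁺ {p} x px = any⁺ p (lose (∈-allFin x) px)

  some⁻ : ∀ {p} → T (some p) → ∃ λ x → T (p x)
  some⁻ {p} t = satisfied (any⁻ p (allFin n) t)

  some-cong : ∀ {p p′} → (∀ x → p x ≡ p′ x) → some p ≡ some p′
  some-cong p≗p′ = cong or (map-cong p≗p′ (allFin n))

  lt⁺ : ∀ {x y} → x ≺ y → T (lt P x y)
  lt⁺ = fromWitness

  lt⁻ : ∀ {x y} → T (lt P x y) → x ≺ y
  lt⁻ = toWitness

  labelAbove : Labeling → ℕ → Fin n → Bool
  labelAbove f j x = some (λ y → lt P x y ∧ (f y ≡ᵇ j))

  labelBelow : Labeling → ℕ → Fin n → Bool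
  labelBelow f j x = some (λ z → lt P z x ∧ (f z ≡ᵇ j))

  module _ {f : Labeling} {j : ℕ} where

    labelAbove⁺ : ∀ {x y} → x ≺ y → f y ≡ j → T (labelAbove f j x)
    labelAbove⁺ {y = y} x≺y fy≡j =
      some⁺ y (Equivalence.from T-∧ (lt⁺ x≺y , ≡⇒≡ᵇ _ _ fy≡j))

    labelAbove⁻ : ∀ {x} → T (labelAbove f j x) → ∃ λ y → x ≺ y × f y ≡ j
    labelAbove⁻ t with some⁻ t
    ... | y , t′ with Equivalence.to T-∧ t′
    ...   | x<y , fy≡ᵇj = y , lt⁻ x<y , ≡ᵇ⇒≡ _ _ fy≡ᵇj

    labelBelow⁺ : ∀ {x z} → z ≺ x → f z ≡ j → T (labelBelow f j x)
    labelBelow⁺ {z = z} z≺x fz≡j =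
      some⁺ z (Equivalence.from T-∧ (lt⁺ z≺x , ≡⇒≡ᵇ _ _ fz≡j))

    labelBelow⁻ : ∀ {x} → T (labelBelow f j x) → ∃ λ z → z ≺ x × f z ≡ j
    labelBelow⁻ t with some⁻ t
    ... | z , t′ with Equivalence.to T-∧ t′
    ...   | z<x , fz≡ᵇj = z , lt⁻ z<x , ≡ᵇ⇒≡ _ _ fz≡ᵇj

  module _ {f g : Labeling} (f≗g : f ≗ g) {j : ℕ} {x : Fin n} where

    labelAbove-cong : labelAbove f j x ≡ labelAbove g j x
    labelAbove-cong = some-cong (λ y → cong (λ v → lt P x y ∧ (v ≡ᵇ j)) (f≗g y))

    labelBelow-cong : labelBelow f j x ≡ labelBelow g j x
    labelBelow-cong = some-cong (λ z → cong (λ v → lt P z x ∧ (v ≡ᵇ j)) (f≗g z))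

  τ : ℕ → Labeling → Labeling
  τ i f x = toggle i (f x) (labelAbove f (suc i) x) (labelBelow f i x)

  τ-cong : ∀ i {f g} → f ≗ g → τ i f ≗ τ i g
  τ-cong i f≗g x = trans (cong (λ v → toggle i v _ _) (f≗g x))
                         (cong₂ (toggle i _) (labelAbove-cong f≗g) (labelBelow-cong f≗g))

  τ-increasing : ∀ i {f} → Increasing f → Increasing (τ i f)
  τ-increasing i {f} f↑ x y x≺y with suc i <? f y | f x <? i
  ... | yes i+1<fy | _ = begin-strict
    τ i f x      ≤⟨ proj₂ (toggle-bounds (f x)) ⟩
    f x ⊔ suc i  <⟨ ⊔-lub (f↑ x y x≺y) i+1<fy ⟩
    f y          ≡⟨ toggle-above i+1<fy ⟨
    τ i f y      ∎
    where open ≤-Reasoning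
  ... | no _ | yes fx<i = begin-strict
    τ i f x      ≡⟨ toggle-below fx<i ⟩
    f x          <⟨ ⊓-glb (f↑ x y x≺y) fx<i ⟩
    f y ⊓ i      ≤⟨ proj₁ (toggle-bounds (f y)) ⟩
    τ i f y      ∎
    where open ≤-Reasoning
  ... | no i+1≮fy | no fx≮i =
    subst₂ _<_ (sym (toggle-at-blocked fx≡i (labelAbove⁺ {f} x≺y fy≡i+1)))
               (sym (toggle-at-suc-blocked fy≡i+1 (labelBelow⁺ {f} x≺y fx≡i)))
               (n<1+n i)
    where
    fx<fy = f↑ x y x≺y
    fy≤i+1 = ≮⇒≥ i+1≮fy
    fx≡i : f x ≡ i
    fx≡i = ≤-antisym (≤-pred (≤-trans fx<fy fy≤i+1)) (≮⇒≥ fx≮i)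
    fy≡i+1 : f y ≡ suc i
    fy≡i+1 = ≤-antisym fy≤i+1 (≤-trans (s≤s (≮⇒≥ fx≮i)) fx<fy)

  τ-Inc : ∀ {q i f} → 1 ≤ i → i < q → Inc P q f → Inc P q (τ i f)
  τ-Inc {q} {i} {f} 1≤i i<q (f-bounds , f↑) = τ-bounds , τ-increasing i f↑
    where
    τ-bounds : ∀ x → 1 ≤ τ i f x × τ i f x ≤ q
    τ-bounds x with f-bounds x | toggle-bounds (f x)
    ... | 1≤fx , fx≤q | lower , upper =
      ≤-trans (⊓-glb 1≤fx 1≤i) lower , ≤-trans upper (⊔-lub fx≤q i<q)

  τ-involutive : ∀ i {f} → Increasing f → τ i (τ i f) ≗ f
  τ-involutive i {f} f↑ x with position i (f x)
  ... | below fx<i = trans (toggle-below (subst (_< i) (sym τfx≡fx) fx<i)) τfx≡fx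
    where τfx≡fx = toggle-below fx<i
  ... | above i+1<fx = trans (toggle-above (subst (suc i <_) (sym τfx≡fx) i+1<fx)) τfx≡fx
    where τfx≡fx = toggle-above i+1<fx
  ... | at fx≡i with T? (labelAbove f (suc i) x)
  ...   | yes blocked with labelAbove⁻ {f} blocked
  ...     | y , x≺y , fy≡i+1 =
    trans (toggle-at-blocked τfx≡i (labelAbove⁺ {τ i f} x≺y τfy≡i+1)) (sym fx≡i)
    where
    τfx≡i = toggle-at-blocked fx≡i blocked
    τfy≡i+1 = toggle-at-suc-blocked fy≡i+1 (labelBelow⁺ {f} x≺y fx≡i)
  τ-involutive i {f} f↑ x | at fx≡i | no free =
    trans (toggle-at-suc-free (toggle-at-free fx≡i free) unblocked) (sym fx≡i)
    where
    unblocked : ¬ T (labelBelow (τ i f) i x)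
    unblocked t with labelBelow⁻ {τ i f} t
    ... | z , z≺x , τfz≡i = <-irrefl (trans (sym (toggle-below fz<i)) τfz≡i) fz<i
      where fz<i = subst (f z <_) fx≡i (f↑ z x z≺x)
  τ-involutive i {f} f↑ x | at-suc fx≡i+1 with T? (labelBelow f i x)
  ...   | yes blocked with labelBelow⁻ {f} blocked
  ...     | z , z≺x , fz≡i =
    trans (toggle-at-suc-blocked τfx≡i+1 (labelBelow⁺ {τ i f} z≺x τfz≡i)) (sym fx≡i+1)
    where
    τfx≡i+1 = toggle-at-suc-blocked fx≡i+1 blocked
    τfz≡i = toggle-at-blocked fz≡i (labelAbove⁺ {f} z≺x fx≡i+1)
  τ-involutive i {f} f↑ x | at-suc fx≡i+1 | no free =
    trans (toggle-at-free (toggle-at-suc-free fx≡i+1 free) unblocked) (sym fx≡i+1)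
    where
    unblocked : ¬ T (labelAbove (τ i f) (suc i) x)
    unblocked t with labelAbove⁻ {τ i f} t
    ... | y , x≺y , τfy≡i+1 = <-irrefl (trans (sym τfy≡i+1) (toggle-above i+1<fy)) i+1<fy
      where i+1<fy = subst (_< f y) fx≡i+1 (f↑ x y x≺y)

  toggles : List ℕ → Labeling → Labeling
  toggles is f = foldr τ f is

  toggles-cong : ∀ is {f g} → f ≗ g → toggles is f ≗ toggles is g
  toggles-cong []       f≗g = f≗g
  toggles-cong (i ∷ is) f≗g = τ-cong i (toggles-cong is f≗g)

  toggles-increasing : ∀ is {f} → Increasing f → Increasing (toggles is f)
  toggles-increasing []       f↑ = f↑
  toggles-increasing (i ∷ is) f↑ = τ-increasing i (toggles-increasing is f↑)

  toggles-Inc : ∀ {q is f} → All (λ i → 1 ≤ i × i < q) is → Inc P q f → Inc P q (toggles is f)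
  toggles-Inc []                   f∈Inc = f∈Inc
  toggles-Inc ((1≤i , i<q) ∷ valid) f∈Inc = τ-Inc 1≤i i<q (toggles-Inc valid f∈Inc)

  toggles-reverse-cancel : ∀ is {f} → Increasing f → toggles (reverse is) (toggles is f) ≗ f
  toggles-reverse-cancel []       f↑ x = refl
  toggles-reverse-cancel (i ∷ is) {f} f↑ x = begin
    toggles (reverse (i ∷ is)) (τ i g) x        ≡⟨ cong (λ js → toggles js (τ i g) x) (unfold-reverse i is) ⟩
    toggles (reverse is ∷ʳ i) (τ i g) x         ≡⟨ cong (_$ x) (foldr-++ τ (τ i g) (reverse is) [ i ]) ⟩
    toggles (reverse is) (τ i (τ i g)) x        ≡⟨ toggles-cong (reverse is) (τ-involutive i g↑) x ⟩
    toggles (reverse is) g x                    ≡⟨ toggles-reverse-cancel is f↑ x ⟩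
    f x                                         ∎
    where
    open ≡-Reasoning
    g = toggles is f
    g↑ = toggles-increasing is f↑

  -- Promotion as a product of toggles

  covers⇒≺ : ∀ {x y} → T (covers P x y) → x ≺ y
  covers⇒≺ t = lt⁻ (proj₁ (Equivalence.to T-∧ t))

  covers-gap : ∀ {H x y} → Increasing H → x ≺ y → H y ≡ suc (H x) → T (covers P x y)
  covers-gap {H} {x} {y} H↑ x≺y Hy≡ =
    Equivalence.from T-∧ (lt⁺ x≺y , Equivalence.from T-not-≡ (¬T⇒≡false no-between))
    where
    no-between : ¬ T (some (λ z → lt P x z ∧ lt P z y))
    no-between t with some⁻ t
    ... | z , t′ with Equivalence.to T-∧ t′
    ...   | x<z , z<y =
      <⇒≱ (H↑ x z (lt⁻ x<z)) (≤-pred (subst (H z <_) Hy≡ (H↑ z y (lt⁻ z<y))))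

  isLabel⁺ : ∀ {i v} → v ≡ just i → T (isLabel P i v)
  isLabel⁺ {i} refl = ≡⇒≡ᵇ i i refl

  isLabel⁻ : ∀ {i} v → T (isLabel P i v) → v ≡ just i
  isLabel⁻ {i} (just j) t = cong just (sym (≡ᵇ⇒≡ i j t))

  isBox⁻ : ∀ v → T (isBox P v) → v ≡ nothing
  isBox⁻ nothing _ = refl

  module SlideStep {k : ℕ} (G : Fin n → Maybe ℕ) (x : Fin n) where

    coverLabeled : Bool
    coverLabeled = some (λ y → covers P x y ∧ isLabel P (suc k) (G y))

    coveredBox : Bool
    coveredBox = some (λ z → covers P z x ∧ isBox P (G z))

    private
      slideStep-at : ∀ {v} → G x ≡ v → slideStep P (suc k) G x ≡
        (if isBox P v ∧ coverLabeled then just (suc k)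
         else (if isLabel P (suc k) v ∧ coveredBox then nothing else v))
      slideStep-at refl = refl

    slideStep-box : G x ≡ nothing →
                    slideStep P (suc k) G x ≡ (if coverLabeled then just (suc k) else nothing)
    slideStep-box = slideStep-at

    slideStep-label : G x ≡ just (suc k) →
                      slideStep P (suc k) G x ≡ (if coveredBox then nothing else just (suc k))
    slideStep-label Gx≡ =
      trans (slideStep-at Gx≡) (cong (λ b → if b ∧ coveredBox then nothing else just (suc k)) (≡ᵇ-refl k))

    slideStep-other : ∀ {j} → G x ≡ just j → j ≢ suc k → slideStep P (suc k) G x ≡ just j
    slideStep-other {j} Gx≡ j≢k+1 =
      trans (slideStep-at Gx≡)
            (cong (λ b → if b ∧ coveredBox then nothing else just j) (≢⇒≡ᵇ-false (j≢k+1 ∘ sym)))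

    module _ (H↑ : Increasing (flatten k ∘ G)) where
      private
        H = flatten k ∘ G

      coverLabeled⇔labelAbove : H x ≡ k → T coverLabeled ⇔ T (labelAbove H (suc k) x)
      coverLabeled⇔labelAbove Hx≡k = mk⇔ to from
        where
        to : T coverLabeled → T (labelAbove H (suc k) x)
        to t with some⁻ t
        ... | y , t′ with Equivalence.to T-∧ t′
        ...   | x⋖y , label = labelAbove⁺ {H} (covers⇒≺ x⋖y)
                                (trans (cong (flatten k) (isLabel⁻ (G y) label)) (flatten-> (n<1+n k)))
        from : T (labelAbove H (suc k) x) → T coverLabeled
        from t with labelAbove⁻ {H} t
        ... | y , x≺y , Hy≡k+1 = some⁺ y (Equivalence.from T-∧
                (covers-gap H↑ x≺y (trans Hy≡k+1 (cong suc (sym Hx≡k))) ,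
                 isLabel⁺ (flatten-≡suc (G y) Hy≡k+1)))

      coveredBox⇔labelBelow : 1 ≤ k → H x ≡ suc k → T coveredBox ⇔ T (labelBelow H k x)
      coveredBox⇔labelBelow 1≤k Hx≡k+1 = mk⇔ to from
        where
        to : T coveredBox → T (labelBelow H k x)
        to t with some⁻ t
        ... | z , t′ with Equivalence.to T-∧ t′
        ...   | z⋖x , box = labelBelow⁺ {H} (covers⇒≺ z⋖x) (cong (flatten k) (isBox⁻ (G z) box))
        from : T (labelBelow H k x) → T coveredBox
        from t with labelBelow⁻ {H} t
        ... | z , z≺x , Hz≡k = some⁺ z (Equivalence.from T-∧
                (covers-gap H↑ z≺x (trans Hx≡k+1 (cong suc (sym Hz≡k))) ,
                 subst (T ∘ isBox P) (sym (flatten-≡ (G z) 1≤k Hz≡k)) _))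

      flatten-slideStep-box : G x ≡ nothing → flatten (suc k) (slideStep P (suc k) G x) ≡ τ k H x
      flatten-slideStep-box Gx≡ with T? coverLabeled
      ... | yes t = begin
        flatten (suc k) (slideStep P (suc k) G x)  ≡⟨ cong (flatten (suc k)) (trans (slideStep-box Gx≡) (if-T t)) ⟩
        flatten (suc k) (just (suc k))              ≡⟨ flatten-≤ {suc k} ≤-refl ⟩
        k                                           ≡⟨ toggle-at-blocked Hx≡k blocked ⟨
        τ k H x                                     ∎
        where open ≡-Reasoning
              Hx≡k = cong (flatten k) Gx≡
              blocked = Equivalence.to (coverLabeled⇔labelAbove Hx≡k) t
      ... | no ¬t = begin
        flatten (suc k) (slideStep P (suc k) G x)  ≡⟨ cong (flatten (suc k)) (trans (slideStep-box Gx≡) (if-¬T ¬t)) ⟩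
        suc k                                       ≡⟨ toggle-at-free Hx≡k free ⟨
        τ k H x                                     ∎
        where open ≡-Reasoning
              Hx≡k = cong (flatten k) Gx≡
              free = ¬t ∘ Equivalence.from (coverLabeled⇔labelAbove Hx≡k)

      flatten-slideStep-label : 1 ≤ k → G x ≡ just (suc k) →
                                flatten (suc k) (slideStep P (suc k) G x) ≡ τ k H x
      flatten-slideStep-label 1≤k Gx≡ with T? coveredBox
      ... | yes t = begin
        flatten (suc k) (slideStep P (suc k) G x)  ≡⟨ cong (flatten (suc k)) (trans (slideStep-label Gx≡) (if-T t)) ⟩
        suc k                                       ≡⟨ toggle-at-suc-blocked Hx≡k+1 blocked ⟨
        τ k H x                                     ∎
        where open ≡-Reasoning
              Hx≡k+1 = trans (cong (flatten k) Gx≡) (flatten-> (n<1+n k))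
              blocked = Equivalence.to (coveredBox⇔labelBelow 1≤k Hx≡k+1) t
      ... | no ¬t = begin
        flatten (suc k) (slideStep P (suc k) G x)  ≡⟨ cong (flatten (suc k)) (trans (slideStep-label Gx≡) (if-¬T ¬t)) ⟩
        flatten (suc k) (just (suc k))              ≡⟨ flatten-≤ {suc k} ≤-refl ⟩
        k                                           ≡⟨ toggle-at-suc-free Hx≡k+1 free ⟨
        τ k H x                                     ∎
        where open ≡-Reasoning
              Hx≡k+1 = trans (cong (flatten k) Gx≡) (flatten-> (n<1+n k))
              free = ¬t ∘ Equivalence.from (coveredBox⇔labelBelow 1≤k Hx≡k+1)

      flatten-slideStep-other : ∀ {j} → 1 ≤ k → G x ≡ just j → j ≢ suc k →
                                flatten (suc k) (slideStep P (suc k) G x) ≡ τ k H x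
      flatten-slideStep-other {j} 1≤k Gx≡ j≢k+1 with j ≤? k
      ... | yes j≤k = begin
        flatten (suc k) (slideStep P (suc k) G x)  ≡⟨ cong (flatten (suc k)) (slideStep-other Gx≡ j≢k+1) ⟩
        flatten (suc k) (just j)                    ≡⟨ flatten-≤ (m≤n⇒m≤1+n j≤k) ⟩
        j ∸ 1                                       ≡⟨ Hx≡j∸1 ⟨
        H x                                         ≡⟨ toggle-below (subst (_< k) (sym Hx≡j∸1) j∸1<k) ⟨
        τ k H x                                     ∎
        where open ≡-Reasoning
              Hx≡j∸1 = trans (cong (flatten k) Gx≡) (flatten-≤ j≤k)
              j∸1<k = m≤n⇒m∸1<n 1≤k j≤k
      ... | no j≰k = begin
        flatten (suc k) (slideStep P (suc k) G x)  ≡⟨ cong (flatten (suc k)) (slideStep-other Gx≡ j≢k+1) ⟩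
        flatten (suc k) (just j)                    ≡⟨ flatten-> k+1<j ⟩
        j                                           ≡⟨ Hx≡j ⟨
        H x                                         ≡⟨ toggle-above (subst (suc k <_) (sym Hx≡j) k+1<j) ⟨
        τ k H x                                     ∎
        where open ≡-Reasoning
              k+1<j = ≤∧≢⇒< (≰⇒> j≰k) (≢-sym j≢k+1)
              Hx≡j = trans (cong (flatten k) Gx≡) (flatten-> (≰⇒> j≰k))

  slideStep-flatten : ∀ {k} → 1 ≤ k → (G : Fin n → Maybe ℕ) → Increasing (flatten k ∘ G) →
                      ∀ x → flatten (suc k) (slideStep P (suc k) G x) ≡ τ k (flatten k ∘ G) x
  slideStep-flatten {k} 1≤k G H↑ x = by-cases (G x) refl
    where
    open SlideStep G x
    by-cases : ∀ v → G x ≡ v → flatten (suc k) (slideStep P (suc k) G x) ≡ τ k (flatten k ∘ G) x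
    by-cases nothing  Gx≡ = flatten-slideStep-box H↑ Gx≡
    by-cases (just j) Gx≡ with j ≟ suc k
    ... | yes refl = flatten-slideStep-label H↑ 1≤k Gx≡
    ... | no j≢k+1 = flatten-slideStep-other H↑ 1≤k Gx≡ j≢k+1

  start : Labeling → Fin n → Maybe ℕ
  start f y = if f y ≡ᵇ 1 then nothing else just (f y)

  flatten-start : ∀ f x → flatten 1 (start f x) ≡ f x
  flatten-start f x with f x
  ... | zero          = refl
  ... | suc zero      = refl
  ... | suc (suc _)   = refl

  slides-flatten : ∀ {f} → Increasing f → ∀ m x →
                   flatten (suc m) (slides P (suc m) (start f) x) ≡ toggles (applyDownFrom suc m) f x
  slides-flatten {f} f↑ zero    x = flatten-start f x
  slides-flatten {f} f↑ (suc m) x =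
    trans (slideStep-flatten (s≤s z≤n) (slides P (suc m) (start f)) H↑ x) (τ-cong (suc m) IH x)
    where
    IH = slides-flatten f↑ m
    H↑ = Increasing-resp (λ y → sym (IH y)) (toggles-increasing (applyDownFrom suc m) f↑)

  proToggles : ℕ → List ℕ
  proToggles q = applyDownFrom suc (q ∸ 1)

  proToggles-valid : ∀ q → All (λ i → 1 ≤ i × i < q) (proToggles q)
  proToggles-valid zero    = []
  proToggles-valid (suc p) = applyDownFrom⁺₁ suc p (λ i<p → s≤s z≤n , s≤s i<p)

  proToggles-reflect : ∀ q → map (q ∸_) (proToggles q) ≡ reverse (proToggles q)
  proToggles-reflect zero    = refl
  proToggles-reflect (suc p) = begin
    map (suc p ∸_) (applyDownFrom suc p)  ≡⟨ map-applyDownFrom suc (suc p ∸_) p ⟩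
    applyDownFrom (p ∸_) p                ≡⟨ applyDownFrom-∸ p ⟩
    applyUpTo suc p                       ≡⟨ reverse-applyDownFrom suc p ⟨
    reverse (applyDownFrom suc p)         ∎
    where open ≡-Reasoning

  Pro-toggles : ∀ {q f} → Inc P q f → Pro P q f ≗ toggles (proToggles q) f
  Pro-toggles {zero} (bounds , _) x with bounds x
  ... | 1≤fx , fx≤0 = contradiction (≤-trans 1≤fx fx≤0) λ ()
  Pro-toggles {suc p} {f} f∈Inc x with slides P (suc p) (start f) x | slides-flatten (proj₂ f∈Inc) p x
  ... | nothing | e = e
  -- Pro lowers the label j by one, as flatten does for j ≤ q; larger labels do not occur.
  ... | just j  | e with j ≤? suc p
  ...   | yes _   = e
  ...   | no j≰q  = contradiction (subst (_≤ suc p) (sym e) toggles≤q) j≰q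
    where toggles≤q = proj₂ (proj₁ (toggles-Inc (proToggles-valid (suc p)) f∈Inc) x)

  -- Orbits of promotion

  module Promotion (q : ℕ) where

    Pro-Inc : ∀ {f} → Inc P q f → Inc P q (Pro P q f)
    Pro-Inc f∈Inc = Inc-resp (λ x → sym (Pro-toggles f∈Inc x)) (toggles-Inc (proToggles-valid q) f∈Inc)

    Pro-cong : ∀ {f g} → Inc P q f → Inc P q g → f ≗ g → Pro P q f ≗ Pro P q g
    Pro-cong f∈Inc g∈Inc f≗g x =
      trans (Pro-toggles f∈Inc x) (trans (toggles-cong (proToggles q) f≗g x) (sym (Pro-toggles g∈Inc x)))

    Pro^ : ℕ → Labeling → Labeling
    Pro^ = iterate (Pro P q)

    Pro^-Inc : ∀ k {f} → Inc P q f → Inc P q (Pro^ k f)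
    Pro^-Inc zero    f∈Inc = f∈Inc
    Pro^-Inc (suc k) f∈Inc = Pro-Inc (Pro^-Inc k f∈Inc)

    Pro^-cong : ∀ k {f g} → Inc P q f → Inc P q g → f ≗ g → Pro^ k f ≗ Pro^ k g
    Pro^-cong zero    _     _     f≗g = f≗g
    Pro^-cong (suc k) f∈Inc g∈Inc f≗g =
      Pro-cong (Pro^-Inc k f∈Inc) (Pro^-Inc k g∈Inc) (Pro^-cong k f∈Inc g∈Inc f≗g)

    Pro^-periodic : ∀ {f N} → Pro^ (suc N) f ≗ f → Inc P q f → ∀ k → Pro^ (k * suc N) f ≗ f
    Pro^-periodic             period f∈Inc zero    x = refl
    Pro^-periodic {f} {N} period f∈Inc (suc k) x = begin
      Pro^ (suc N + k * suc N) f x      ≡⟨ cong (_$ x) (iterate-+ (Pro P q) (suc N) (k * suc N) f) ⟩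
      Pro^ (suc N) (Pro^ (k * suc N) f) x
                                        ≡⟨ Pro^-cong (suc N) (Pro^-Inc (k * suc N) f∈Inc) f∈Inc
                                                      (Pro^-periodic period f∈Inc k) x ⟩
      Pro^ (suc N) f x                  ≡⟨ period x ⟩
      f x                               ∎
      where open ≡-Reasoning

  module Swap {κ : Fin n → Fin n} (κ-selfDual : IsSelfDual P κ) (q : ℕ) where
    open IsSelfDual κ-selfDual
    open Promotion q

    sw : Labeling → Labeling
    sw = swap P q κ

    swap-cong : ∀ {f g} → f ≗ g → sw f ≗ sw g
    swap-cong f≗g x = cong (suc q ∸_) (f≗g (κ x))

    swap-κ : ∀ f x → sw f (κ x) ≡ suc q ∸ f x
    swap-κ f x = cong (λ y → suc q ∸ f y) (involutive x)

    swap-involutive : ∀ {f} → Inc P q f → sw (sw f) ≗ f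
    swap-involutive {f} f∈Inc x = trans (cong (suc q ∸_) (swap-κ f x)) (m∸[m∸n]≡n (Inc-≤suc f∈Inc x))

    swap-Inc : ∀ {f} → Inc P q f → Inc P q (sw f)
    swap-Inc {f} (f-bounds , f↑) = bounds , increasing
      where
      bounds : ∀ x → 1 ≤ sw f x × sw f x ≤ q
      bounds x with f-bounds (κ x)
      ... | 1≤f , f≤q = m<n⇒0<n∸m (s≤s f≤q) , ∸-monoʳ-≤ (suc q) 1≤f
      increasing : Increasing (sw f)
      increasing x y x≺y =
        ∸-monoʳ-< (f↑ (κ y) (κ x) (order-reversing x y x≺y)) (m≤n⇒m≤1+n (proj₂ (f-bounds (κ x))))

    module _ {f : Labeling} (f≤q+1 : ∀ x → f x ≤ suc q) {j : ℕ} (j≤q+1 : j ≤ suc q) {x : Fin n} where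

      labelAbove-swap : labelAbove f j (κ x) ≡ labelBelow (sw f) (suc q ∸ j) x
      labelAbove-swap = T-injective (mk⇔ to from)
        where
        to : T (labelAbove f j (κ x)) → T (labelBelow (sw f) (suc q ∸ j) x)
        to t with labelAbove⁻ {f} t
        ... | y , κx≺y , fy≡j = labelBelow⁺ {sw f}
          (subst (κ y ≺_) (involutive x) (order-reversing _ _ κx≺y))
          (trans (swap-κ f y) (cong (suc q ∸_) fy≡j))
        from : T (labelBelow (sw f) (suc q ∸ j) x) → T (labelAbove f j (κ x))
        from t with labelBelow⁻ {sw f} t
        ... | z , z≺x , swfz≡ = labelAbove⁺ {f}
          (order-reversing _ _ z≺x) (∸-cancelˡ-≡ (f≤q+1 (κ z)) j≤q+1 swfz≡)

      labelBelow-swap : labelBelow f j (κ x) ≡ labelAbove (sw f) (suc q ∸ j) x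
      labelBelow-swap = T-injective (mk⇔ to from)
        where
        to : T (labelBelow f j (κ x)) → T (labelAbove (sw f) (suc q ∸ j) x)
        to t with labelBelow⁻ {f} t
        ... | z , z≺κx , fz≡j = labelAbove⁺ {sw f}
          (subst (_≺ κ z) (involutive x) (order-reversing _ _ z≺κx))
          (trans (swap-κ f z) (cong (suc q ∸_) fz≡j))
        from : T (labelAbove (sw f) (suc q ∸ j) x) → T (labelBelow f j (κ x))
        from t with labelAbove⁻ {sw f} t
        ... | y , x≺y , swfy≡ = labelBelow⁺ {f}
          (order-reversing _ _ x≺y) (∸-cancelˡ-≡ (f≤q+1 (κ y)) j≤q+1 swfy≡)

    swap-τ : ∀ {i f} → i ≤ q → Inc P q f → sw (τ i f) ≗ τ (q ∸ i) (sw f)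
    swap-τ {i} {f} i≤q f∈Inc x = begin
      suc q ∸ toggle i (f (κ x)) (labelAbove f (suc i) (κ x)) (labelBelow f i (κ x))
        ≡⟨ toggle-reflect _ _ i≤q (f≤q+1 (κ x)) ⟩
      toggle (q ∸ i) (sw f x) (labelBelow f i (κ x)) (labelAbove f (suc i) (κ x))
        ≡⟨ cong₂ (toggle (q ∸ i) (sw f x)) below≡ (labelAbove-swap f≤q+1 (s≤s i≤q)) ⟩
      τ (q ∸ i) (sw f) x ∎
      where
      open ≡-Reasoning
      f≤q+1 = Inc-≤suc f∈Inc
      below≡ : labelBelow f i (κ x) ≡ labelAbove (sw f) (suc (q ∸ i)) x
      below≡ = trans (labelBelow-swap f≤q+1 (m≤n⇒m≤1+n i≤q))
                     (cong (λ j → labelAbove (sw f) j x) (+-∸-assoc 1 i≤q))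

    swap-toggles : ∀ {is f} → All (λ i → 1 ≤ i × i < q) is → Inc P q f →
                   sw (toggles is f) ≗ toggles (map (q ∸_) is) (sw f)
    swap-toggles []                     f∈Inc = λ _ → refl
    swap-toggles {i ∷ is} ((_ , i<q) ∷ valid) f∈Inc x =
      trans (swap-τ (<⇒≤ i<q) (toggles-Inc valid f∈Inc) x) (τ-cong (q ∸ i) (swap-toggles valid f∈Inc) x)

    Pro-swap-Pro : ∀ {h} → Inc P q h → Pro P q (sw (Pro P q h)) ≗ sw h
    Pro-swap-Pro {h} h∈Inc x = begin
      Pro P q (sw (Pro P q h)) x        ≡⟨ Pro-toggles (swap-Inc (Pro-Inc h∈Inc)) x ⟩
      toggles L (sw (Pro P q h)) x      ≡⟨ toggles-cong L (swap-cong (Pro-toggles h∈Inc)) x ⟩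
      toggles L (sw (toggles L h)) x    ≡⟨ toggles-cong L (swap-toggles (proToggles-valid q) h∈Inc) x ⟩
      toggles L (toggles M (sw h)) x    ≡⟨ cong (λ is → toggles is (toggles M (sw h)) x) L≡reverse-M ⟩
      toggles (reverse M) (toggles M (sw h)) x
                                        ≡⟨ toggles-reverse-cancel M (proj₂ (swap-Inc h∈Inc)) x ⟩
      sw h x                            ∎
      where
      open ≡-Reasoning
      L = proToggles q
      M = map (q ∸_) L
      L≡reverse-M : L ≡ reverse M
      L≡reverse-M = trans (sym (reverse-involutive L)) (cong reverse (sym (proToggles-reflect q)))

    Pro-injective : ∀ {f g} → Inc P q f → Inc P q g → Pro P q f ≗ Pro P q g → f ≗ g
    Pro-injective {f} {g} f∈Inc g∈Inc Pf≗Pg x = begin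
      f x          ≡⟨ swap-involutive f∈Inc x ⟨
      sw (sw f) x  ≡⟨ swap-cong swf≗swg x ⟩
      sw (sw g) x  ≡⟨ swap-involutive g∈Inc x ⟩
      g x          ∎
      where
      open ≡-Reasoning
      swf≗swg : sw f ≗ sw g
      swf≗swg y = begin
        sw f y                      ≡⟨ Pro-swap-Pro f∈Inc y ⟨
        Pro P q (sw (Pro P q f)) y  ≡⟨ Pro-cong (swap-Inc (Pro-Inc f∈Inc)) (swap-Inc (Pro-Inc g∈Inc))
                                               (swap-cong Pf≗Pg) y ⟩
        Pro P q (sw (Pro P q g)) y  ≡⟨ Pro-swap-Pro g∈Inc y ⟩
        sw g y                      ∎

    Pro^-injective : ∀ k {f g} → Inc P q f → Inc P q g → Pro^ k f ≗ Pro^ k g → f ≗ g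
    Pro^-injective zero    _     _     Pf≗Pg = Pf≗Pg
    Pro^-injective (suc k) f∈Inc g∈Inc Pf≗Pg =
      Pro^-injective k f∈Inc g∈Inc (Pro-injective (Pro^-Inc k f∈Inc) (Pro^-Inc k g∈Inc) Pf≗Pg)

    Pro^-swap-Pro^ : ∀ j {h} → Inc P q h → Pro^ j (sw (Pro^ j h)) ≗ sw h
    Pro^-swap-Pro^ zero    h∈Inc x = refl
    Pro^-swap-Pro^ (suc j) {h} h∈Inc x = begin
      Pro^ (suc j) (sw (Pro^ (suc j) h)) x         ≡⟨ cong (_$ x) (iterate-suc (Pro P q) j _) ⟩
      Pro^ j (Pro P q (sw (Pro P q (Pro^ j h)))) x  ≡⟨ Pro^-cong j (Pro-Inc (swap-Inc (Pro-Inc hⱼ∈Inc)))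
                                                                (swap-Inc hⱼ∈Inc) (Pro-swap-Pro hⱼ∈Inc) x ⟩
      Pro^ j (sw (Pro^ j h)) x                      ≡⟨ Pro^-swap-Pro^ j h∈Inc x ⟩
      sw h x                                        ∎
      where
      open ≡-Reasoning
      hⱼ∈Inc = Pro^-Inc j h∈Inc

    Pro-periodic : ∀ {f} → Inc P q f → ∃ λ N → Pro^ (suc N) f ≗ f
    Pro-periodic {f} f∈Inc = period (pigeonhole (n<1+n (suc q ^ n)) code)
      where
      bound : ∀ k x → Pro^ k f x ≤ q
      bound k = proj₂ ∘ proj₁ (Pro^-Inc k f∈Inc)

      code : Fin (suc (suc q ^ n)) → Fin (suc q ^ n)
      code i = encode (Pro^ (toℕ i) f) (bound (toℕ i))

      period : (∃₂ λ i j → toℕ i < toℕ j × code i ≡ code j) → ∃ λ N → Pro^ (suc N) f ≗ f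
      period (i , j , i<j , same-code) =
        N , λ x → sym (Pro^-injective (toℕ i) f∈Inc (Pro^-Inc (suc N) f∈Inc) orbit-meets x)
        where
        N = toℕ j ∸ suc (toℕ i)
        orbit-meets : Pro^ (toℕ i) f ≗ Pro^ (toℕ i) (Pro^ (suc N) f)
        orbit-meets x = begin
          Pro^ (toℕ i) f x                 ≡⟨ encode-injective (bound (toℕ i)) (bound (toℕ j)) same-code x ⟩
          Pro^ (toℕ j) f x                 ≡⟨ cong (λ k → Pro^ k f x) (m+[n∸m]≡n i<j) ⟨
          Pro^ (suc (toℕ i + N)) f x       ≡⟨ cong (λ k → Pro^ k f x) (+-suc (toℕ i) N) ⟨
          Pro^ (toℕ i + suc N) f x         ≡⟨ cong (_$ x) (iterate-+ (Pro P q) (toℕ i) (suc N) f) ⟩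
          Pro^ (toℕ i) (Pro^ (suc N) f) x  ∎
          where open ≡-Reasoning

    Pro^-inverse : ∀ {f} → Inc P q f → ∀ k → ∃ λ m → Pro^ m (Pro^ k f) ≗ f
    Pro^-inverse {f} f∈Inc k with Pro-periodic f∈Inc
    ... | N , period = k * N , λ x → begin
      Pro^ (k * N) (Pro^ k f) x   ≡⟨ cong (_$ x) (iterate-+ (Pro P q) (k * N) k f) ⟨
      Pro^ (k * N + k) f x        ≡⟨ cong (λ m → Pro^ m f x) (trans (+-comm (k * N) k) (sym (*-suc k N))) ⟩
      Pro^ (k * suc N) f x        ≡⟨ Pro^-periodic period f∈Inc k x ⟩
      f x                         ∎
      where open ≡-Reasoning

corollary5p10 : (P : FinPoset) (κ : Fin (FinPoset.n P) → Fin (FinPoset.n P))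
    → IsSelfDual P κ → (q : ℕ) (f : Fin (FinPoset.n P) → ℕ) → Inc P q f
    → Σ (Fin (FinPoset.n P) → ℕ) λ g → Inc P q g
        × (∀ k → ∃ λ m → swap P q κ (iterate (Pro P q) k f) ≗ iterate (Pro P q) m g)
corollary5p10 P κ κ-selfDual q f f∈Inc = sw f , swap-Inc f∈Inc , swap-orbit
  where
  open Labelings P
  open Promotion q
  open Swap κ-selfDual q
  swap-orbit : ∀ k → ∃ λ m → sw (Pro^ k f) ≗ Pro^ m (sw f)
  swap-orbit k with Pro^-inverse f∈Inc k
  ... | m , Pro^m∘Pro^k≗id = m , λ x → begin
    sw (Pro^ k f) x                    ≡⟨ Pro^-swap-Pro^ m fₖ∈Inc x ⟨
    Pro^ m (sw (Pro^ m (Pro^ k f))) x  ≡⟨ Pro^-cong m (swap-Inc (Pro^-Inc m fₖ∈Inc)) (swap-Inc f∈Inc)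
                                                      (swap-cong Pro^m∘Pro^k≗id) x ⟩
    Pro^ m (sw f) x                    ∎
    where
    open ≡-Reasoning
    fₖ∈Inc = Pro^-Inc k f∈Inc
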